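{- For $n \geq 2r$ and $3 \leq t \leq r+1$, the family $\mathcal{AHM}_t\subseteq\binom{[n]}{r}$ is an MLCIF.
   Context: $[a,b]=\{a,\dots,b\}$; $\binom{[n]}{r}$ is the family of $r$-subsets of $[n]=\{1,\dots,n\}$. A family is intersecting if no two members are disjoint. For $A=\{a_1<\dots<a_r\}$, $B=\{b_1<\dots<b_r\}$ write $B\le A$ if $b_i\le a_i$ for all $i$; $\mathcal{A}$ is left-compressed if $A\in\mathcal{A}$, $B\le A$ imply $B\in\mathcal{A}$. An MLCIF is a left-compressed intersecting family in $\binom{[n]}{r}$ maximal under inclusion among such families. With $\mathcal{S}=\{A\in\binom{[n]}{r}:1\in A\}$, define $\mathcal{AHM}_t=\{A\in\mathcal{S}: A\cap[2,t]\ne\emptyset\}\cup\{A\in\binom{[n]}{r}:[2,t]\subseteq A\}$. -}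

module Defs where

open import Level using (0ℓ)
open import Data.Nat using (ℕ; zero; suc; _≤_)
open import Data.Bool using (Bool; true; false)
open import Data.Vec using (Vec; []; _∷_)
open import Data.List using (List; map)
import Data.List using ([]; _∷_)
open import Data.List.Membership.Propositional using (_∈_)
open import Data.List.Relation.Binary.Pointwise using (Pointwise)
open import Data.Fin.Subset using (Subset; ∣_∣; _∩_; Nonempty)
open import Data.Product using (_×_; ∃-syntax)
open import Data.Sum using (_⊎_)
open import Relation.Binary.PropositionalEquality using (_≡_)

-- A subset of [n] = {1,…,n} is a Subset n (Vec Bool n); position i (0-based)
-- stands for the element i+1 of [n].

elems : ∀ {n} → Subset n → List ℕ
elems [] = Data.List.[]
elems (true ∷ p) = 1 Data.List.∷ map suc (elems p)
elems (false ∷ p) = map suc (elems p)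

_∈[_] : ∀ {n} → ℕ → Subset n → Set
k ∈[ A ] = k ∈ elems A

Family : ℕ → Set₁
Family n = Subset n → Set

IsRFamily : ∀ {n} → ℕ → Family n → Set
IsRFamily r 𝓐 = ∀ A → 𝓐 A → ∣ A ∣ ≡ r

Intersecting : ∀ {n} → Family n → Set
Intersecting 𝓐 = ∀ A B → 𝓐 A → 𝓐 B → Nonempty (A ∩ B)

-- B ≤ A  iff  b_i ≤ a_i for all i (elements listed increasingly;
-- used for sets of the same size r, where the lists have equal length)
_≼_ : ∀ {n} → Subset n → Subset n → Set
B ≼ A = Pointwise _≤_ (elems B) (elems A)

LeftCompressed : ∀ {n} → ℕ → Family n → Set
LeftCompressed r 𝓐 = ∀ A B → 𝓐 A → ∣ B ∣ ≡ r → B ≼ A → 𝓐 B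

LCIF : ∀ n → ℕ → Family n → Set
LCIF n r 𝓐 = IsRFamily r 𝓐 × Intersecting 𝓐 × LeftCompressed r 𝓐

MLCIF : ∀ n → ℕ → Family n → Set₁
MLCIF n r 𝓐 =
  LCIF n r 𝓐 ×
  ((𝓑 : Family n) → LCIF n r 𝓑 → (∀ A → 𝓐 A → 𝓑 A) → ∀ B → 𝓑 B → 𝓐 B)

AHM : ∀ n → ℕ → ℕ → Family n
AHM n r t A =
  ∣ A ∣ ≡ r ×
  ((1 ∈[ A ] × ∃[ j ] (2 ≤ j × j ≤ t × j ∈[ A ]))
   ⊎ (∀ j → 2 ≤ j → j ≤ t → j ∈[ A ]))

-- AHM_t consists of the r-sets containing 1 and meeting [2,t], and those containing [2,t];
-- any two members share 1, 2, or a point of [2,t].  A compression lowers the sorted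
-- elements coordinatewise: it keeps 1, moves a point of [2,t] that is not the minimum to
-- another one, and keeps an initial segment {1,…,m}; so a set ⊇ [2,t] without 1 either
-- keeps [2,t] or gains 1 and a second element ≤ 3 ≤ t.
-- For maximality, an r-set B outside AHM_t either contains 1 and misses [2,t], or misses 1
-- and some j ∈ [2,t].  Then [2,t] resp. {1,j} is a set of at most r points outside B all of
-- whose supersets satisfy the AHM_t condition, and since n − r ≥ r it extends to a member
-- of AHM_t disjoint from B.
module Submission where

open import Defs
open import Data.Nat using (ℕ; zero; suc; _+_; _*_; _∸_; _≤_; _<_; z≤n; s≤s; _≤?_)
open import Data.Nat.Properties
open import Data.Empty using (⊥-elim)
open import Data.Fin using (Fin; zero; suc; toℕ; fromℕ<)
open import Data.Fin.Properties using (toℕ-fromℕ<)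
open import Data.Fin.Subset
  using (Subset; inside; outside; _∈_; _∉_; _⊆_; ∁; _∩_; _∪_; _─_; ⁅_⁆; ⊥; ∣_∣; Nonempty)
open import Data.Fin.Subset.Properties
open import Data.Vec using ([]; _∷_; here; there)
open import Data.List.Membership.Propositional using () renaming (_∈_ to _∈ₗ_)
open import Data.List.Membership.Propositional.Properties using (∈-map⁺; ∈-map⁻)
open import Data.List.Membership.DecPropositional _≟_ using () renaming (_∈?_ to _∈ₗ?_)
open import Data.List.Relation.Unary.Any using (here; there)
open import Data.List.Relation.Binary.Pointwise as Pointwise using (Pointwise; []; _∷_; map⁻)
open import Data.Product using (_×_; ∃-syntax; _,_; proj₁)
open import Data.Sum using (_⊎_; inj₁; inj₂)
open import Relation.Nullary using (¬_; Dec; yes; no)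
open import Relation.Nullary.Decidable using (map′; decidable-stable; _×-dec_; ¬?)
open import Relation.Binary.PropositionalEquality using (_≡_; refl; sym; trans; cong; cong₂; subst)
open import Function using (_∘_)

Pointwise-∈ʳ : ∀ {a b ℓ} {A : Set a} {B : Set b} {R : A → B → Set ℓ} {xs ys y} →
  Pointwise R xs ys → y ∈ₗ ys → ∃[ x ] (x ∈ₗ xs × R x y)
Pointwise-∈ʳ (Rxy ∷ _) (here refl) = _ , here refl , Rxy
Pointwise-∈ʳ (_ ∷ Rxsys) (there y∈ys) with Pointwise-∈ʳ Rxsys y∈ys
... | x , x∈xs , Rxy = x , there x∈xs , Rxy

∣p∪q∣≤∣p∣+∣q∣ : ∀ {n} (p q : Subset n) → ∣ p ∪ q ∣ ≤ ∣ p ∣ + ∣ q ∣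
∣p∪q∣≤∣p∣+∣q∣ [] [] = z≤n
∣p∪q∣≤∣p∣+∣q∣ (outside ∷ p) (outside ∷ q) = ∣p∪q∣≤∣p∣+∣q∣ p q
∣p∪q∣≤∣p∣+∣q∣ (inside ∷ p) (outside ∷ q) = s≤s (∣p∪q∣≤∣p∣+∣q∣ p q)
∣p∪q∣≤∣p∣+∣q∣ (outside ∷ p) (inside ∷ q) =
  ≤-trans (s≤s (∣p∪q∣≤∣p∣+∣q∣ p q)) (≤-reflexive (sym (+-suc ∣ p ∣ ∣ q ∣)))
∣p∪q∣≤∣p∣+∣q∣ (inside ∷ p) (inside ∷ q) =
  s≤s (≤-trans (∣p∪q∣≤∣p∣+∣q∣ p q) (+-monoʳ-≤ ∣ p ∣ (n≤1+n ∣ q ∣)))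

∣⁅x⁆∪⁅y⁆∣≤2 : ∀ {n} (x y : Fin n) → ∣ ⁅ x ⁆ ∪ ⁅ y ⁆ ∣ ≤ 2
∣⁅x⁆∪⁅y⁆∣≤2 x y =
  ≤-trans (∣p∪q∣≤∣p∣+∣q∣ ⁅ x ⁆ ⁅ y ⁆) (≤-reflexive (cong₂ _+_ (∣⁅x⁆∣≡1 x) (∣⁅x⁆∣≡1 y)))

⁅x⁆∪⁅y⁆⊆∁ : ∀ {n} {x y : Fin n} {p : Subset n} → x ∉ p → y ∉ p → ⁅ x ⁆ ∪ ⁅ y ⁆ ⊆ ∁ p
⁅x⁆∪⁅y⁆⊆∁ {x = x} {y} x∉p y∉p z∈ with x∈p∪q⁻ ⁅ x ⁆ ⁅ y ⁆ z∈
... | inj₁ z∈⁅x⁆ rewrite x∈⁅y⁆⇒x≡y x z∈⁅x⁆ = x∉p⇒x∈∁p x∉p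
... | inj₂ z∈⁅y⁆ rewrite x∈⁅y⁆⇒x≡y y z∈⁅y⁆ = x∉p⇒x∈∁p y∉p

x∈p─q⇒x∉q : ∀ {n} {p q : Subset n} {x} → x ∈ p ─ q → x ∉ q
x∈p─q⇒x∉q {p = inside ∷ _} {outside ∷ _} here ()
x∈p─q⇒x∉q {p = _ ∷ _} {_ ∷ _} (there x∈p─q) (there x∈q) = x∈p─q⇒x∉q x∈p─q x∈q

⊆-sandwich : ∀ {n} k {p q : Subset n} → p ⊆ q → ∣ p ∣ ≤ k → k ≤ ∣ q ∣ →
  ∃[ s ] (p ⊆ s × s ⊆ q × ∣ s ∣ ≡ k)
⊆-sandwich zero {[]} {[]} _ _ _ = [] , (λ ()) , (λ ()) , refl
⊆-sandwich k {inside ∷ p} {outside ∷ q} p⊆q with p⊆q here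
... | ()
⊆-sandwich (suc k) {inside ∷ p} {inside ∷ q} p⊆q (s≤s p≤k) (s≤s k≤q)
  with ⊆-sandwich k (drop-∷-⊆ p⊆q) p≤k k≤q
... | s , p⊆s , s⊆q , refl = inside ∷ s , s⊆s p⊆s , s⊆s s⊆q , refl
⊆-sandwich k {outside ∷ p} {outside ∷ q} p⊆q p≤k k≤q
  with ⊆-sandwich k (drop-∷-⊆ p⊆q) p≤k k≤q
... | s , p⊆s , s⊆q , refl = outside ∷ s , s⊆s p⊆s , s⊆s s⊆q , refl
⊆-sandwich k {outside ∷ p} {inside ∷ q} p⊆q p≤k k≤1+q with k ≤? ∣ q ∣
... | yes k≤q with ⊆-sandwich k (drop-∷-⊆ p⊆q) p≤k k≤q
...   | s , p⊆s , s⊆q , refl = outside ∷ s , s⊆s p⊆s , out⊆ s⊆q , refl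
⊆-sandwich zero {outside ∷ p} {inside ∷ q} _ _ _ | no 0≰q = ⊥-elim (0≰q z≤n)
⊆-sandwich (suc k) {outside ∷ p} {inside ∷ q} p⊆q p≤k (s≤s k≤q) | no k≰q
  with ⊆-sandwich k (drop-∷-⊆ p⊆q) p≤k′ k≤q
  where
  p≤k′ : ∣ p ∣ ≤ k
  p≤k′ = ≤-trans (p⊆q⇒∣p∣≤∣q∣ (drop-∷-⊆ p⊆q)) (≤-pred (≰⇒> k≰q))
... | s , p⊆s , s⊆q , refl = inside ∷ s , out⊆ p⊆s , s⊆s s⊆q , refl

initial : ∀ {n} → ℕ → Subset n
initial {zero} _ = []
initial {suc n} zero = ⊥
initial {suc n} (suc m) = inside ∷ initial m

∣initial∣≤ : ∀ {n} m → ∣ initial {n} m ∣ ≤ m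
∣initial∣≤ {zero} _ = z≤n
∣initial∣≤ {suc n} zero = ≤-reflexive (∣⊥∣≡0 n)
∣initial∣≤ {suc n} (suc m) = s≤s (∣initial∣≤ {n} m)

toℕ<⇒∈initial : ∀ {n m} (i : Fin n) → toℕ i < m → i ∈ initial m
toℕ<⇒∈initial {m = suc m} zero _ = here
toℕ<⇒∈initial {m = suc m} (suc i) (s≤s i<m) = there (toℕ<⇒∈initial i i<m)

∈[]-∷ : ∀ {n} s (p : Subset n) {k} → k ∈[ p ] → suc k ∈[ s ∷ p ]
∈[]-∷ inside p k∈p = there (∈-map⁺ suc k∈p)
∈[]-∷ outside p k∈p = ∈-map⁺ suc k∈p

∈[]-∷⁻ : ∀ {n} s (p : Subset n) {k} → suc k ∈[ s ∷ p ] → (s ≡ inside × k ≡ 0) ⊎ k ∈[ p ]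
∈[]-∷⁻ inside p (here refl) = inj₁ (refl , refl)
∈[]-∷⁻ inside p (there k∈p) with ∈-map⁻ suc k∈p
... | _ , k∈p′ , refl = inj₂ k∈p′
∈[]-∷⁻ outside p k∈p with ∈-map⁻ suc k∈p
... | _ , k∈p′ , refl = inj₂ k∈p′

∈[]⇒index : ∀ {n} (p : Subset n) {k} → k ∈[ p ] → ∃[ i ] suc (toℕ {n} i) ≡ k
∈[]⇒index (inside ∷ p) (here refl) = zero , refl
∈[]⇒index (inside ∷ p) (there k∈p) with ∈-map⁻ suc k∈p
... | _ , k∈p′ , refl with ∈[]⇒index p k∈p′
...   | i , refl = suc i , refl
∈[]⇒index (outside ∷ p) k∈p with ∈-map⁻ suc k∈p
... | _ , k∈p′ , refl with ∈[]⇒index p k∈p′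
...   | i , refl = suc i , refl

0∉[] : ∀ {n} (p : Subset n) → ¬ 0 ∈[ p ]
0∉[] p 0∈p with ∈[]⇒index p 0∈p
... | _ , ()

1∈[]⇒inside : ∀ {n} s (p : Subset n) → 1 ∈[ s ∷ p ] → s ≡ inside
1∈[]⇒inside s p 1∈p with ∈[]-∷⁻ s p 1∈p
... | inj₁ (s≡inside , _) = s≡inside
... | inj₂ 0∈p = ⊥-elim (0∉[] p 0∈p)

∈[]-suc∷⁻ : ∀ {n} s (p : Subset n) {k} → suc (suc k) ∈[ s ∷ p ] → suc k ∈[ p ]
∈[]-suc∷⁻ s p k∈p with ∈[]-∷⁻ s p k∈p
... | inj₂ k∈p′ = k∈p′

∈[]-outside⇒2≤ : ∀ {n} (q : Subset n) {x} → x ∈[ outside ∷ q ] → 2 ≤ x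
∈[]-outside⇒2≤ q x∈q with ∈-map⁻ suc x∈q
... | _ , y∈q , refl with ∈[]⇒index q y∈q
...   | _ , refl = s≤s (s≤s z≤n)

index-of : ∀ {n} k → 1 ≤ k → k ≤ n → ∃[ i ] suc (toℕ {n} i) ≡ k
index-of (suc k) _ k<n = fromℕ< k<n , cong suc (toℕ-fromℕ< k<n)

∈⇒∈[] : ∀ {n} {p : Subset n} {i k} → suc (toℕ i) ≡ k → i ∈ p → k ∈[ p ]
∈⇒∈[] refl here = here refl
∈⇒∈[] {p = s ∷ p} refl (there i∈p) = ∈[]-∷ s p (∈⇒∈[] refl i∈p)

∈[]⇒∈ : ∀ {n} (p : Subset n) {i k} → suc (toℕ i) ≡ k → k ∈[ p ] → i ∈ p
∈[]⇒∈ (s ∷ p) {zero} refl 1∈p with 1∈[]⇒inside s p 1∈p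
... | refl = here
∈[]⇒∈ (s ∷ p) {suc i} refl k∈p with ∈[]-∷⁻ s p k∈p
... | inj₂ k∈p′ = there (∈[]⇒∈ p refl k∈p′)

⊆-∈[] : ∀ {n} (p q : Subset n) {k} → p ⊆ q → k ∈[ p ] → k ∈[ q ]
⊆-∈[] p q p⊆q k∈p with ∈[]⇒index p k∈p
... | _ , i↦k = ∈⇒∈[] i↦k (p⊆q (∈[]⇒∈ p i↦k k∈p))

common⇒Nonempty : ∀ {n} (A B : Subset n) {k} → k ∈[ A ] → k ∈[ B ] → Nonempty (A ∩ B)
common⇒Nonempty A B k∈A k∈B with ∈[]⇒index A k∈A
... | i , i↦k = i , x∈p∩q⁺ (∈[]⇒∈ A i↦k k∈A , ∈[]⇒∈ B i↦k k∈B)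

Covers : ∀ {n} → ℕ → ℕ → Subset n → Set
Covers a b A = ∀ j → a ≤ j → j ≤ b → j ∈[ A ]

Meets : ∀ {n} → ℕ → ℕ → Subset n → Set
Meets a b A = ∃[ j ] (a ≤ j × j ≤ b × j ∈[ A ])

AHMCondition : ∀ {n} → ℕ → Subset n → Set
AHMCondition t A = (1 ∈[ A ] × Meets 2 t A) ⊎ Covers 2 t A

AHMCondition-mono : ∀ {n t} (A B : Subset n) → A ⊆ B →
  AHMCondition t A → AHMCondition t B
AHMCondition-mono A B A⊆B (inj₁ (1∈A , j , 2≤j , j≤t , j∈A)) =
  inj₁ (⊆-∈[] A B A⊆B 1∈A , j , 2≤j , j≤t , ⊆-∈[] A B A⊆B j∈A)
AHMCondition-mono A B A⊆B (inj₂ cov) = inj₂ λ j 2≤j j≤t → ⊆-∈[] A B A⊆B (cov j 2≤j j≤t)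

Covers-mono : ∀ {n a a′ b b′} (A : Subset n) → a ≤ a′ → b′ ≤ b →
  Covers a b A → Covers a′ b′ A
Covers-mono A a≤a′ b′≤b cov j a′≤j j≤b′ = cov j (≤-trans a≤a′ a′≤j) (≤-trans j≤b′ b′≤b)

Covers-∷ : ∀ {n a b} s (p : Subset n) → Covers a b p → Covers (suc a) (suc b) (s ∷ p)
Covers-∷ s p cov (suc j) (s≤s a≤j) (s≤s j≤b) = ∈[]-∷ s p (cov j a≤j j≤b)

Covers-∷⁻ : ∀ {n a b} s (p : Subset n) → 1 ≤ a →
  Covers (suc a) (suc b) (s ∷ p) → Covers a b p
Covers-∷⁻ s p 1≤a cov zero a≤0 _ = ⊥-elim (≤⇒≯ a≤0 1≤a)
Covers-∷⁻ s p 1≤a cov (suc j) a≤j j≤b =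
  ∈[]-suc∷⁻ s p (cov (suc (suc j)) (s≤s a≤j) (s≤s j≤b))

Covers-inside∷ : ∀ {n m} (q : Subset n) → Covers 1 m q → Covers 1 (suc m) (inside ∷ q)
Covers-inside∷ q cov (suc zero) _ _ = here refl
Covers-inside∷ q cov (suc (suc j)) _ (s≤s j≤m) =
  ∈[]-∷ inside q (cov (suc j) (s≤s z≤n) j≤m)

∷-≼⁻ : ∀ {n} s (p q : Subset n) → (s ∷ q) ≼ (s ∷ p) → q ≼ p
∷-≼⁻ inside p q (_ ∷ q≼p) = Pointwise.map ≤-pred (map⁻ suc suc q≼p)
∷-≼⁻ outside p q q≼p = Pointwise.map ≤-pred (map⁻ suc suc q≼p)

≼-preserves-1∈ : ∀ {n} (A B : Subset n) → B ≼ A → 1 ∈[ A ] → 1 ∈[ B ]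
≼-preserves-1∈ (a ∷ p) (inside ∷ q) _ _ = here refl
≼-preserves-1∈ (a ∷ p) (outside ∷ q) B≼A 1∈A with 1∈[]⇒inside a p 1∈A
... | refl with Pointwise-∈ʳ B≼A (here refl)
...   | x , x∈B , x≤1 = ⊥-elim (≤⇒≯ x≤1 (∈[]-outside⇒2≤ q x∈B))

≼-preserves-Meets : ∀ {n t} (A B : Subset n) → B ≼ A → 1 ∈[ A ] →
  Meets 2 t A → Meets 2 t B
≼-preserves-Meets (a ∷ p) (b ∷ q) B≼A 1∈A (j , 2≤j , j≤t , j∈A)
  with 1∈[]⇒inside a p 1∈A | 1∈[]⇒inside b q (≼-preserves-1∈ (a ∷ p) (b ∷ q) B≼A 1∈A)
... | refl | refl with j∈A | B≼A
...   | here refl | _ = ⊥-elim (<-irrefl refl 2≤j)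
...   | there j∈A′ | _ ∷ q≼p with Pointwise-∈ʳ q≼p j∈A′
...     | x , x∈B′ , x≤j = x , ∈[]-outside⇒2≤ q x∈B′ , ≤-trans x≤j j≤t , there x∈B′

≼-preserves-prefix : ∀ {n} m (p q : Subset n) → q ≼ p → Covers 1 m p → Covers 1 m q
≼-preserves-prefix zero _ _ _ _ j 1≤j j≤0 = ⊥-elim (≤⇒≯ j≤0 1≤j)
≼-preserves-prefix (suc m) [] [] _ cov with cov 1 ≤-refl (s≤s z≤n)
... | ()
≼-preserves-prefix (suc m) (a ∷ p) (b ∷ q) q≼p cov with cov 1 ≤-refl (s≤s z≤n)
... | 1∈p with 1∈[]⇒inside a p 1∈p | 1∈[]⇒inside b q (≼-preserves-1∈ (a ∷ p) (b ∷ q) q≼p 1∈p)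
...   | refl | refl =
  Covers-inside∷ q (≼-preserves-prefix m p q (∷-≼⁻ inside p q q≼p) cov′)
  where
  cov′ : Covers 1 m p
  cov′ = Covers-∷⁻ inside p ≤-refl (Covers-mono (inside ∷ p) (n≤1+n 1) ≤-refl cov)

-- The sorted elements of outside ∷ p begin 2, 3; the second one of inside ∷ q is at most 3.
inside∷≼outside∷⇒Meets : ∀ {n} (p q : Subset n) →
  (inside ∷ q) ≼ (outside ∷ p) → Covers 1 2 p → Meets 2 3 (inside ∷ q)
inside∷≼outside∷⇒Meets [] q _ cov with cov 1 ≤-refl (s≤s z≤n)
... | ()
inside∷≼outside∷⇒Meets (a ∷ []) q _ cov with ∈[]-suc∷⁻ a [] (cov 2 (s≤s z≤n) ≤-refl)
... | ()
inside∷≼outside∷⇒Meets (a ∷ a′ ∷ p) q B≼A cov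
  with 1∈[]⇒inside a (a′ ∷ p) (cov 1 ≤-refl (s≤s z≤n))
     | 1∈[]⇒inside a′ p (∈[]-suc∷⁻ a (a′ ∷ p) (cov 2 (s≤s z≤n) ≤-refl))
... | refl | refl with B≼A
...   | _ ∷ q≼p with Pointwise-∈ʳ q≼p (here refl)
...     | x , x∈q , x≤3 = x , ∈[]-outside⇒2≤ q x∈q , x≤3 , there x∈q

≼-preserves-Covers : ∀ {n t} (A B : Subset n) → 3 ≤ t → B ≼ A →
  Covers 2 t A → AHMCondition t B
≼-preserves-Covers [] [] 3≤t _ cov with cov 2 ≤-refl (≤-trans (n≤1+n 2) 3≤t)
... | ()
≼-preserves-Covers (inside ∷ p) B 3≤t B≼A cov =
  inj₁ (≼-preserves-1∈ A B B≼A (here refl) ,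
        ≼-preserves-Meets A B B≼A (here refl) (2 , ≤-refl , 2≤t , cov 2 ≤-refl 2≤t))
  where
  A = inside ∷ p
  2≤t = ≤-trans (n≤1+n 2) 3≤t
≼-preserves-Covers {t = suc t} (outside ∷ p) (outside ∷ q) (s≤s 2≤t) B≼A cov =
  inj₂ (Covers-∷ outside q (≼-preserves-prefix t p q (∷-≼⁻ outside p q B≼A)
                                                    (Covers-∷⁻ outside p ≤-refl cov)))
≼-preserves-Covers {t = suc t} (outside ∷ p) (inside ∷ q) 3≤t@(s≤s 2≤t) B≼A cov
  with inside∷≼outside∷⇒Meets p q B≼A
         (Covers-mono p ≤-refl 2≤t (Covers-∷⁻ outside p ≤-refl cov))
... | x , 2≤x , x≤3 , x∈B = inj₁ (here refl , x , 2≤x , ≤-trans x≤3 3≤t , x∈B)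

AHM-intersecting : ∀ {n r t} → 2 ≤ t → Intersecting (AHM n r t)
AHM-intersecting _ A B (_ , inj₁ (1∈A , _)) (_ , inj₁ (1∈B , _)) =
  common⇒Nonempty A B 1∈A 1∈B
AHM-intersecting _ A B (_ , inj₁ (_ , j , 2≤j , j≤t , j∈A)) (_ , inj₂ covB) =
  common⇒Nonempty A B j∈A (covB j 2≤j j≤t)
AHM-intersecting _ A B (_ , inj₂ covA) (_ , inj₁ (_ , j , 2≤j , j≤t , j∈B)) =
  common⇒Nonempty A B (covA j 2≤j j≤t) j∈B
AHM-intersecting 2≤t A B (_ , inj₂ covA) (_ , inj₂ covB) =
  common⇒Nonempty A B (covA 2 ≤-refl 2≤t) (covB 2 ≤-refl 2≤t)

AHM-leftCompressed : ∀ {n r t} → 3 ≤ t → LeftCompressed r (AHM n r t)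
AHM-leftCompressed _ A B (_ , inj₁ (1∈A , meets)) ∣B∣≡r B≼A =
  ∣B∣≡r , inj₁ (≼-preserves-1∈ A B B≼A 1∈A , ≼-preserves-Meets A B B≼A 1∈A meets)
AHM-leftCompressed 3≤t A B (_ , inj₂ cov) ∣B∣≡r B≼A =
  ∣B∣≡r , ≼-preserves-Covers A B 3≤t B≼A cov

_∈[_]? : ∀ {n} k (p : Subset n) → Dec (k ∈[ p ])
k ∈[ p ]? = k ∈ₗ? elems p

Meets? : ∀ {n} a b (A : Subset n) → Dec (Meets a b A)
Meets? a b A =
  map′ (λ { (j , s≤s j≤b , a≤j , j∈A) → j , a≤j , j≤b , j∈A })
       (λ { (j , a≤j , j≤b , j∈A) → j , s≤s j≤b , a≤j , j∈A })
       (anyUpTo? (λ j → (a ≤? j) ×-dec (j ∈[ A ]?)) (suc b))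

Covers⊎misses : ∀ {n} a b (A : Subset n) →
  Covers a b A ⊎ ∃[ j ] (a ≤ j × j ≤ b × ¬ j ∈[ A ])
Covers⊎misses a b A with anyUpTo? (λ j → (a ≤? j) ×-dec ¬? (j ∈[ A ]?)) (suc b)
... | yes (j , s≤s j≤b , a≤j , j∉A) = inj₂ (j , a≤j , j≤b , j∉A)
... | no ∄ = inj₁ λ j a≤j j≤b →
  decidable-stable (j ∈[ A ]?) λ j∉A → ∄ (j , s≤s j≤b , a≤j , j∉A)

module _ {n r t : ℕ} (2r≤n : 2 * r ≤ n) (3≤t : 3 ≤ t) (t≤1+r : t ≤ suc r) where

  private
    2≤r : 2 ≤ r
    2≤r = ≤-pred (≤-trans 3≤t t≤1+r)

    r+r≤n : r + r ≤ n
    r+r≤n = subst (_≤ n) (cong (r +_) (+-identityʳ r)) 2r≤n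

    t≤n : t ≤ n
    t≤n = ≤-trans t≤1+r (≤-trans (+-monoˡ-≤ r (≤-trans (s≤s z≤n) 2≤r)) r+r≤n)

    1≤t : 1 ≤ t
    1≤t = ≤-trans (s≤s z≤n) 3≤t

  disjoint-member-from-seed : ∀ B D → ∣ B ∣ ≡ r → D ⊆ ∁ B → ∣ D ∣ ≤ r → AHMCondition t D →
    ∃[ C ] (AHM n r t C × C ⊆ ∁ B)
  disjoint-member-from-seed B D ∣B∣≡r D⊆∁B ∣D∣≤r cond with ⊆-sandwich r D⊆∁B ∣D∣≤r r≤∣∁B∣
    where
    r≤∣∁B∣ : r ≤ ∣ ∁ B ∣
    r≤∣∁B∣ = subst (r ≤_) (sym (trans (∣∁p∣≡n∸∣p∣ B) (cong (n ∸_) ∣B∣≡r)))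
                   (m+n≤o⇒m≤o∸n r r+r≤n)
  ... | C , D⊆C , C⊆∁B , ∣C∣≡r = C , (∣C∣≡r , AHMCondition-mono D C D⊆C cond) , C⊆∁B

  disjoint-member-if-misses : ∀ B → ∣ B ∣ ≡ r → 1 ∈[ B ] → ¬ Meets 2 t B →
    ∃[ C ] (AHM n r t C × C ⊆ ∁ B)
  disjoint-member-if-misses B ∣B∣≡r 1∈B ∄ =
    disjoint-member-from-seed B D ∣B∣≡r D⊆∁B ∣D∣≤r (inj₂ D-covers)
    where
    -- since 1 ∈ B and B misses [2,t], this is exactly [2,t], of size t − 1 ≤ r
    D = initial t ─ B

    D⊆∁B : D ⊆ ∁ B
    D⊆∁B = x∉p⇒x∈∁p ∘ x∈p─q⇒x∉q {p = initial t}

    initial∩B : Nonempty (initial t ∩ B)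
    initial∩B with ∈[]⇒index B 1∈B
    ... | i , i↦1 =
      i , x∈p∩q⁺ (toℕ<⇒∈initial i (subst (_≤ t) (sym i↦1) 1≤t) , ∈[]⇒∈ B i↦1 1∈B)

    ∣D∣≤r : ∣ D ∣ ≤ r
    ∣D∣≤r = ≤-pred (≤-trans (p∩q≢∅⇒∣p─q∣<∣p∣ (initial t) B initial∩B)
                            (≤-trans (∣initial∣≤ {n} t) t≤1+r))

    D-covers : Covers 2 t D
    D-covers j 2≤j j≤t with index-of j (≤-trans (s≤s z≤n) 2≤j) (≤-trans j≤t t≤n)
    ... | i , refl = ∈⇒∈[] refl (x∈p∧x∉q⇒x∈p─q (toℕ<⇒∈initial i j≤t) i∉B)
      where
      i∉B : i ∉ B
      i∉B i∈B = ∄ (_ , 2≤j , j≤t , ∈⇒∈[] refl i∈B)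

  disjoint-member-if-gap : ∀ B → ∣ B ∣ ≡ r → ¬ 1 ∈[ B ] → ∀ j → 2 ≤ j → j ≤ t → ¬ j ∈[ B ] →
    ∃[ C ] (AHM n r t C × C ⊆ ∁ B)
  disjoint-member-if-gap B ∣B∣≡r 1∉B j 2≤j j≤t j∉B
    with index-of 1 ≤-refl (≤-trans 1≤t t≤n) | index-of j (≤-trans (s≤s z≤n) 2≤j) (≤-trans j≤t t≤n)
  ... | i₁ , i₁↦1 | iⱼ , refl =
    disjoint-member-from-seed B (⁅ i₁ ⁆ ∪ ⁅ iⱼ ⁆) ∣B∣≡r
      (⁅x⁆∪⁅y⁆⊆∁ (1∉B ∘ ∈⇒∈[] i₁↦1) (j∉B ∘ ∈⇒∈[] refl))
      (≤-trans (∣⁅x⁆∪⁅y⁆∣≤2 i₁ iⱼ) 2≤r)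
      (inj₁ (∈⇒∈[] i₁↦1 (p⊆p∪q ⁅ iⱼ ⁆ (x∈⁅x⁆ i₁)) ,
             _ , 2≤j , j≤t , ∈⇒∈[] refl (q⊆p∪q ⁅ i₁ ⁆ ⁅ iⱼ ⁆ (x∈⁅x⁆ iⱼ))))

  AHM⊎disjoint-member : ∀ B → ∣ B ∣ ≡ r →
    AHMCondition t B ⊎ ∃[ C ] (AHM n r t C × C ⊆ ∁ B)
  AHM⊎disjoint-member B ∣B∣≡r with 1 ∈[ B ]? | Meets? 2 t B | Covers⊎misses 2 t B
  ... | yes 1∈B | yes meets | _ = inj₁ (inj₁ (1∈B , meets))
  ... | yes 1∈B | no ∄ | _ = inj₂ (disjoint-member-if-misses B ∣B∣≡r 1∈B ∄)
  ... | no _ | _ | inj₁ cov = inj₁ (inj₂ cov)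
  ... | no 1∉B | _ | inj₂ (j , 2≤j , j≤t , j∉B) =
    inj₂ (disjoint-member-if-gap B ∣B∣≡r 1∉B j 2≤j j≤t j∉B)

  AHM-maximal : (𝓑 : Family n) → LCIF n r 𝓑 → (∀ A → AHM n r t A → 𝓑 A) →
    ∀ B → 𝓑 B → AHM n r t B
  AHM-maximal 𝓑 (r-family , intersecting , _) AHM⊆𝓑 B B∈𝓑
    with AHM⊎disjoint-member B (r-family B B∈𝓑)
  ... | inj₁ cond = r-family B B∈𝓑 , cond
  ... | inj₂ (C , C∈AHM , C⊆∁B) with intersecting C B (AHM⊆𝓑 C C∈AHM) B∈𝓑
  ...   | i , i∈C∩B with x∈p∩q⁻ C B i∈C∩B
  ...     | i∈C , i∈B = ⊥-elim (x∈∁p⇒x∉p (C⊆∁B i∈C) i∈B)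

proposition2p5 : (n r t : ℕ) → 2 * r ≤ n → 3 ≤ t → t ≤ suc r →
    MLCIF n r (AHM n r t)
proposition2p5 n r t 2r≤n 3≤t t≤1+r =
  ((λ _ → proj₁) , AHM-intersecting (≤-trans (n≤1+n 2) 3≤t) , AHM-leftCompressed 3≤t) ,
  AHM-maximal 2r≤n 3≤t t≤1+r
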